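{- Let $G$ be a totally decomposable graph with reduced clique-star split-decomposition tree $T$. Then $G$ has no induced diamond if and only if $T$ has no clique-center path.
   Context: All graphs are finite, simple and connected. A diamond is the graph obtained from the complete graph $K_4$ by deleting one edge. A graph-labeled tree $(T,\mathcal{F})$ is a tree $T$ in which each internal node $v$, of degree $k$, carries a graph $G_v$ on $k$ vertices (its marker vertices) and a bijection $\rho_v$ from the tree edges incident to $v$ onto $V(G_v)$; edges of $G_v$ are interior edges. A clique-node is an internal node $v$ with $G_v$ complete; a star-node is one with $G_v$ a star $K_{1,k-1}$, whose vertex adjacent to all others is its center and whose other vertices are its extremities. Form the auxiliary graph whose vertices are the leaves of $T$ and all marker vertices, and whose edges are all interior edges together with, for each tree edge $e=\{v,w\}$, an edge joining $\rho_v(e)$ (or $v$ if $v$ is a leaf) to $\rho_w(e)$ (or $w$ if $w$ is a leaf). An alternated path is a path in this auxiliary graph containing at most one interior edge of each $G_v$. A clique-center path is an alternated path whose endpoints are the center of a star-node $u$ and a marker vertex of a clique-node $v$, and which contains no interior edge of $G_u$ or of $G_v$. The accessibility graph of $(T,\mathcal{F})$ has the leaves of $T$ as vertices, two leaves being adjacent iff an alternated path joins them. A split of a graph $H$ is a bipartition $(V_1,V_2)$ of $V(H)$ with $|V_1|,|V_2|\ge 2$ such that every vertex of $V_1$ with a neighbour in $V_2$ is adjacent to every vertex of $V_2$ with a neighbour in $V_1$; a graph with no split is prime. (Cunningham) Every connected graph $G$ is the accessibility graph, with leaves identified with $V(G)$, of a unique graph-labeled tree, its reduced split-decomposition tree,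 in which every label is a prime graph, a clique or a star, every internal node has degree at least 3, no tree edge joins two clique-nodes, and no tree edge joins the center of a star-node to an extremity of another star-node. It is a clique-star tree if all labels are cliques or stars, and $G$ is then called totally decomposable (equivalently, distance-hereditary). -}

module Defs where

open import Data.Nat using (ℕ; zero; suc; _≤_)
open import Data.Fin using (Fin)
open import Data.Fin.Base using ()
open import Data.List using (List; []; _∷_; length; filterᵇ; allFin; last; zip; drop; lookup)
open import Data.List.Relation.Unary.Linked using (Linked)
open import Data.List.Relation.Unary.AllPairs using (AllPairs)
open import Data.Bool using (Bool; true; false)
open import Data.Maybe using (Maybe; just)
open import Data.Product using (Σ; ∃; _×_; _,_)
open import Data.Sum using (_⊎_)
open import Relation.Nullary using (¬_)
open import Relation.Binary.PropositionalEquality using (_≡_; _≢_)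

record SimpleGraph (m : ℕ) : Set where
  field
    adj    : Fin m → Fin m → Bool
    sym    : ∀ x y → adj x y ≡ adj y x
    irrefl : ∀ x → adj x x ≡ false

data Reach {m : ℕ} (adj : Fin m → Fin m → Bool) : Fin m → Fin m → Set where
  here : ∀ {x} → Reach adj x x
  step : ∀ {x y z} → adj x y ≡ true → Reach adj y z → Reach adj x z

Connected : ∀ {m} → SimpleGraph m → Set
Connected {zero}  G = Data.Empty.⊥ where import Data.Empty
Connected {suc m} G = ∀ x y → Reach (SimpleGraph.adj G) x y

HasInducedDiamond : ∀ {m} → SimpleGraph m → Set
HasInducedDiamond {m} G =
  Σ (Fin m) λ a → Σ (Fin m) λ b → Σ (Fin m) λ c → Σ (Fin m) λ d →
    (a ≢ b × a ≢ c × a ≢ d × b ≢ c × b ≢ d × c ≢ d) ×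
    (adj a b ≡ true × adj a c ≡ true × adj a d ≡ true ×
     adj b c ≡ true × adj b d ≡ true × adj c d ≡ false)
  where open SimpleGraph G

-- The marker vertices of an internal
-- node v are identified with the tree edges incident to v, i.e. with the
-- tree-neighbours w of v (so rho_v is the identity); the label G_v is
-- given by  lab v : Fin n → Fin n → Bool  restricted to neighbours of v.

record LabeledTree (n : ℕ) : Set where
  field
    tadj    : Fin n → Fin n → Bool
    tsym    : ∀ x y → tadj x y ≡ tadj y x
    tirrefl : ∀ x → tadj x x ≡ false
    lab     : Fin n → Fin n → Fin n → Bool   -- lab v a b : markers a,b of v adjacent in G_v
    lsym    : ∀ v a b → lab v a b ≡ lab v b a
    lirrefl : ∀ v a → lab v a a ≡ false

  deg : Fin n → ℕ
  deg v = length (filterᵇ (tadj v) (allFin n))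

  Leaf : Fin n → Set
  Leaf v = deg v ≤ 1

  Internal : Fin n → Set
  Internal v = 2 ≤ deg v

  Marker : Fin n → Fin n → Set
  Marker v a = Internal v × tadj v a ≡ true

  CliqueNode : Fin n → Set
  CliqueNode v = Internal v ×
    (∀ a b → tadj v a ≡ true → tadj v b ≡ true → a ≢ b → lab v a b ≡ true)

  IsCenter : Fin n → Fin n → Set
  IsCenter v c = Internal v × tadj v c ≡ true ×
    (∀ b → tadj v b ≡ true → b ≢ c → lab v c b ≡ true) ×
    (∀ a b → tadj v a ≡ true → tadj v b ≡ true → a ≢ c → b ≢ c → lab v a b ≡ false)

  StarNode : Fin n → Set
  StarNode v = Σ (Fin n) λ c → IsCenter v c

  IsExtremity : Fin n → Fin n → Set
  IsExtremity v e = tadj v e ≡ true × Σ (Fin n) λ c → IsCenter v c × e ≢ c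

  IsTree : Set
  IsTree = (∀ x y → Reach tadj x y) ×
    (¬ Σ (List (Fin n)) λ cyc → 3 ≤ length cyc × AllPairs _≢_ cyc ×
        Linked (λ x y → tadj x y ≡ true) cyc ×
        Σ (Fin n) λ f → Σ (Fin n) λ l →
          (Data.List.head cyc ≡ just f) × (last cyc ≡ just l) × tadj l f ≡ true)
    where import Data.List

  -- Auxiliary graph: vertices are leaves  lf x  and marker vertices  mk v a
  data AuxV : Set where
    lf : Fin n → AuxV
    mk : Fin n → Fin n → AuxV

  -- the endpoint at v of the tree edge {v,w}
  data End (v w : Fin n) : AuxV → Set where
    leafEnd : Leaf v → End v w (lf v)
    markEnd : Internal v → End v w (mk v w)

  data AuxEdge : AuxV → AuxV → Set where
    interior : ∀ {v a b} → Marker v a → Marker v b → a ≢ b →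
               lab v a b ≡ true → AuxEdge (mk v a) (mk v b)
    treeEdge : ∀ {v w x y} → tadj v w ≡ true → End v w x → End w v y →
               AuxEdge x y

  -- a consecutive pair of a path is an interior edge of G_v
  InteriorAt : Fin n → AuxV × AuxV → Set
  InteriorAt v (x , y) = Σ (Fin n) λ a → Σ (Fin n) λ b → x ≡ mk v a × y ≡ mk v b

  steps : List AuxV → List (AuxV × AuxV)
  steps xs = zip xs (drop 1 xs)

  -- alternated path from x to y (vertex list x ∷ ws)
  record AltPath (x y : AuxV) : Set where
    field
      ws       : List AuxV
      ends     : last (x ∷ ws) ≡ just y
      distinct : AllPairs _≢_ (x ∷ ws)
      edges    : Linked AuxEdge (x ∷ ws)
      alt      : ∀ v (i j : Fin (length (steps (x ∷ ws)))) →
                 InteriorAt v (lookup (steps (x ∷ ws)) i) →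
                 InteriorAt v (lookup (steps (x ∷ ws)) j) → i ≡ j

  HasCliqueCenterPath : Set
  HasCliqueCenterPath =
    Σ (Fin n) λ u → Σ (Fin n) λ c → Σ (Fin n) λ v → Σ (Fin n) λ a →
      IsCenter u c × CliqueNode v × tadj v a ≡ true ×
      Σ (AltPath (mk u c) (mk v a)) λ p →
        ∀ k → ¬ InteriorAt u (lookup (steps (mk u c ∷ AltPath.ws p)) k)
            × ¬ InteriorAt v (lookup (steps (mk u c ∷ AltPath.ws p)) k)

  -- label conditions of graph-labeled trees (G_v is a graph on its markers)
  -- are built in; reduced clique-star conditions:
  IsReducedCliqueStar : Set
  IsReducedCliqueStar =
    IsTree ×
    (∀ v → Internal v → 3 ≤ deg v) ×
    (∀ v → Internal v → CliqueNode v ⊎ StarNode v) ×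
    (∀ v w → tadj v w ≡ true → ¬ (CliqueNode v × CliqueNode w)) ×
    (∀ v w → tadj v w ≡ true → ¬ (IsCenter v w × IsExtremity w v))

-- G is the accessibility graph of (T,F), leaves identified with V(G)

IsAccessibilityGraph : ∀ {m n} → SimpleGraph m → LabeledTree n → Set
IsAccessibilityGraph {m} {n} G L =
  Σ (Fin m → Fin n) λ φ →
    (∀ x y → φ x ≡ φ y → x ≡ y) ×
    (∀ x → Leaf (φ x)) ×
    (∀ ℓ → Leaf ℓ → Σ (Fin m) λ x → φ x ≡ ℓ) ×
    (∀ x y → x ≢ y → (SimpleGraph.adj G x y ≡ true → AltPath (lf (φ x)) (lf (φ y)))
                     × (AltPath (lf (φ x)) (lf (φ y)) → SimpleGraph.adj G x y ≡ true))
  where open LabeledTree L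

-- T is the reduced split-decomposition tree of G and it is clique-star
-- (so G is totally decomposable)
IsReducedCliqueStarTreeOf : ∀ {m n} → SimpleGraph m → LabeledTree n → Set
IsReducedCliqueStarTreeOf G L =
  LabeledTree.IsReducedCliqueStar L × IsAccessibilityGraph G L

module Submission where

-- A good walk is a sequence of tree nodes, consecutive ones adjacent, never
-- turning straight back, and passing each inner node p along an interior edge
-- of G_p.  In a tree walks are paths determined by their ends; good walks are
-- exactly the traces of alternated paths; and in a clique-star tree every tree
-- edge extends to a good walk ending at a leaf (a branch).  Both sides of the
-- lemma are shown equivalent to the existence of diamond leaves: four leaves
-- pairwise joined by alternated paths except for one pair.
-- (⇒) From a clique-center path u c … a v, branches through two extremities of
-- the star u and two further markers of the clique v end at diamond leaves.
-- (⇐) The good walks from a to c and to d fork at a star t whose center α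
-- points to a, and the same t, α arise from b; the branches from t through α
-- to a and b fork at a clique s, and t α … s is a clique-center path.

open import Defs
open import Data.Nat using (ℕ; zero; suc; _≤_; _<_; z≤n; s≤s; _+_; _≤?_)
open import Data.Nat.Properties using (≤-trans; +-suc; m≤m+n; <⇒≱; ≰⇒>)
open import Data.Fin using (Fin; zero; suc) renaming (_≟_ to _≟F_)
open import Data.Fin.Properties using (suc-injective; injective⇒≤)
open import Data.List using (List; []; _∷_; _++_; reverse; last; length; lookup; filterᵇ; allFin)
open import Data.List.Properties using (++-assoc; unfold-reverse; reverse-++; reverse-involutive; length-++-sucʳ; ∷-injective)
open import Data.List.Relation.Unary.All as All using (All; []; _∷_)
open import Data.List.Relation.Unary.All.Properties using (++⁻ˡ)
open import Data.List.Relation.Unary.AllPairs using (AllPairs; []; _∷_)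
open import Data.List.Relation.Unary.Linked using (Linked; []; [-]; _∷_)
open import Data.List.Relation.Unary.Any using (here; there)
open import Data.List.Relation.Unary.Any.Properties using (++⁺ʳ; reverse⁺)
open import Data.List.Relation.Unary.Unique.Propositional using (Unique)
import Data.List.Relation.Unary.Unique.Propositional.Properties as Unique
open import Data.List.Membership.Propositional using (_∈_)
open import Data.List.Membership.Propositional.Properties using (∈-∃++; ∈-filter⁺; ∈-filter⁻; ∈-allFin; ∈-lookup)
open import Data.Bool using (true; false)
open import Data.Bool.Properties using (T-≡; T?)
open import Data.Maybe using (just)
open import Data.Maybe.Properties using (just-injective)
open import Data.Product using (Σ; _×_; _,_; proj₁; proj₂)
open import Data.Sum using (_⊎_; inj₁; inj₂)
open import Data.Unit using (⊤; tt)
open import Data.Empty using (⊥; ⊥-elim)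
open import Relation.Nullary using (¬_; yes; no)
open import Function.Bundles using (_⇔_; mk⇔; Equivalence)
open import Function.Properties.Equivalence using () renaming (trans to ⇔-trans; sym to ⇔-sym)
open import Function.Related.TypeIsomorphisms using (¬-cong-⇔)
open import Function using (_∘_)
open import Relation.Binary.PropositionalEquality

module ListFacts {A : Set} where

  Chain : (A → A → Set) → List A → Set
  Chain R (x ∷ y ∷ r) = R x y × Chain R (y ∷ r)
  Chain R _ = ⊤

  Chain₃ : (A → A → A → Set) → List A → Set
  Chain₃ R (x ∷ y ∷ z ∷ r) = R x y z × Chain₃ R (y ∷ z ∷ r)
  Chain₃ R _ = ⊤

  Chain-tail : ∀ {R} x xs → Chain R (x ∷ xs) → Chain R xs
  Chain-tail x [] c = tt
  Chain-tail x (y ∷ xs) c = proj₂ c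

  Chain₃-tail : ∀ {R} x xs → Chain₃ R (x ∷ xs) → Chain₃ R xs
  Chain₃-tail x [] c = tt
  Chain₃-tail x (y ∷ []) c = tt
  Chain₃-tail x (y ∷ z ∷ xs) c = proj₂ c

  Chain-++ : ∀ {R} P a Q → Chain R (P ++ a ∷ []) → Chain R (a ∷ Q) → Chain R (P ++ a ∷ Q)
  Chain-++ [] a Q p q = q
  Chain-++ (x ∷ []) a Q p q = proj₁ p , q
  Chain-++ (x ∷ y ∷ P) a Q p q = proj₁ p , Chain-++ (y ∷ P) a Q (proj₂ p) q

  Chain₃-++ : ∀ {R} P a b Q → Chain₃ R (P ++ a ∷ b ∷ []) → Chain₃ R (a ∷ b ∷ Q) → Chain₃ R (P ++ a ∷ b ∷ Q)
  Chain₃-++ [] a b Q p q = q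
  Chain₃-++ (x ∷ []) a b Q p q = proj₁ p , q
  Chain₃-++ (x ∷ y ∷ []) a b Q p q = proj₁ p , proj₁ (proj₂ p) , q
  Chain₃-++ (x ∷ y ∷ z ∷ P) a b Q p q = proj₁ p , Chain₃-++ (y ∷ z ∷ P) a b Q (proj₂ p) q

  Chain-prefix : ∀ {R} xs ys → Chain R (xs ++ ys) → Chain R xs
  Chain-prefix [] ys c = tt
  Chain-prefix (x ∷ []) ys c = tt
  Chain-prefix (x ∷ y ∷ xs) ys c = proj₁ c , Chain-prefix (y ∷ xs) ys (proj₂ c)

  Chain₃-suffix : ∀ {R} xs ys → Chain₃ R (xs ++ ys) → Chain₃ R ys
  Chain₃-suffix [] ys c = c
  Chain₃-suffix (x ∷ xs) ys c = Chain₃-suffix xs ys (Chain₃-tail x (xs ++ ys) c)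

  Chain⇒Linked : ∀ {R} xs → Chain R xs → Linked R xs
  Chain⇒Linked [] c = []
  Chain⇒Linked (x ∷ []) c = [-]
  Chain⇒Linked (x ∷ y ∷ xs) c = proj₁ c ∷ Chain⇒Linked (y ∷ xs) (proj₂ c)

  reverse-∷∷ : ∀ (x y : A) ys → reverse (x ∷ y ∷ ys) ≡ reverse ys ++ y ∷ x ∷ []
  reverse-∷∷ x y ys = begin
    reverse (x ∷ y ∷ ys)               ≡⟨ unfold-reverse x (y ∷ ys) ⟩
    reverse (y ∷ ys) ++ x ∷ []         ≡⟨ cong (_++ x ∷ []) (unfold-reverse y ys) ⟩
    (reverse ys ++ y ∷ []) ++ x ∷ []   ≡⟨ ++-assoc (reverse ys) (y ∷ []) (x ∷ []) ⟩
    reverse ys ++ y ∷ x ∷ []           ∎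
    where open ≡-Reasoning

  reverse-∷∷∷ : ∀ (x y z : A) zs → reverse (x ∷ y ∷ z ∷ zs) ≡ reverse zs ++ z ∷ y ∷ x ∷ []
  reverse-∷∷∷ x y z zs = begin
    reverse (x ∷ y ∷ z ∷ zs)                ≡⟨ unfold-reverse x (y ∷ z ∷ zs) ⟩
    reverse (y ∷ z ∷ zs) ++ x ∷ []          ≡⟨ cong (_++ x ∷ []) (reverse-∷∷ y z zs) ⟩
    (reverse zs ++ z ∷ y ∷ []) ++ x ∷ []    ≡⟨ ++-assoc (reverse zs) (z ∷ y ∷ []) (x ∷ []) ⟩
    reverse zs ++ z ∷ y ∷ x ∷ []            ∎
    where open ≡-Reasoning

  Chain-reverse : ∀ {R} → (∀ {x y} → R x y → R y x) → ∀ xs → Chain R xs → Chain R (reverse xs)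
  Chain-reverse s [] c = tt
  Chain-reverse s (x ∷ []) c = tt
  Chain-reverse {R} s (x ∷ y ∷ ys) c = subst (Chain R) (sym (reverse-∷∷ x y ys))
    (Chain-++ (reverse ys) y (x ∷ [])
      (subst (Chain R) (unfold-reverse y ys) (Chain-reverse s (y ∷ ys) (proj₂ c))) (s (proj₁ c) , tt))

  Chain₃-reverse : ∀ {R} → (∀ {x y z} → R x y z → R z y x) → ∀ xs → Chain₃ R xs → Chain₃ R (reverse xs)
  Chain₃-reverse s [] c = tt
  Chain₃-reverse s (x ∷ []) c = tt
  Chain₃-reverse s (x ∷ y ∷ []) c = tt
  Chain₃-reverse {R} s (x ∷ y ∷ z ∷ zs) c = subst (Chain₃ R) (sym (reverse-∷∷∷ x y z zs))
    (Chain₃-++ (reverse zs) z y (x ∷ [])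
      (subst (Chain₃ R) (reverse-∷∷ y z zs) (Chain₃-reverse s (y ∷ z ∷ zs) (proj₂ c))) (s (proj₁ c) , tt))

  final : A → List A → A
  final x [] = x
  final x (y ∷ ys) = final y ys

  last-final : ∀ x xs → last (x ∷ xs) ≡ just (final x xs)
  last-final x [] = refl
  last-final x (y ∷ ys) = last-final y ys

  final-∈ : ∀ x xs → final x xs ∈ x ∷ xs
  final-∈ x [] = here refl
  final-∈ x (y ∷ ys) = there (final-∈ y ys)

  final-++ : ∀ x (P : List A) y Q → final x (P ++ y ∷ Q) ≡ final y Q
  final-++ x [] y Q = refl
  final-++ x (z ∷ P) y Q = final-++ z P y Q

  last-∈ : ∀ (xs : List A) {y} → last xs ≡ just y → y ∈ xs
  last-∈ (x ∷ []) refl = here refl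
  last-∈ (x ∷ x' ∷ xs) e = there (last-∈ (x' ∷ xs) e)

  final-split : ∀ x L P y Q → x ∷ L ≡ P ++ y ∷ Q → final x L ≡ final y Q
  final-split x L [] y Q refl = refl
  final-split x L (z ∷ P) y Q refl = final-++ x P y Q

  final-reverse-prefix : ∀ x L pre (α : A) M → x ∷ L ≡ pre ++ α ∷ M → final α (reverse pre) ≡ x
  final-reverse-prefix x L [] α M refl = refl
  final-reverse-prefix x L (z ∷ pre) α M refl =
    trans (cong (final α) (unfold-reverse z pre)) (final-++ α (reverse pre) z [])

  reverse-final : ∀ (x : A) X' → Σ (List A) λ K → reverse X' ++ x ∷ [] ≡ final x X' ∷ K
  reverse-final x [] = [] , refl
  reverse-final x (y ∷ X'') with reverse-final y X''
  ... | K , e = K ++ x ∷ [] , cong (_++ x ∷ []) (trans (unfold-reverse y X'') e)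

  Unique-last-head : ∀ (x : A) P → Unique (x ∷ P) → last (x ∷ P) ≡ just x → P ≡ []
  Unique-last-head x [] u e = refl
  Unique-last-head x (p ∷ P) (a ∷ _) e = ⊥-elim (All.lookup a (last-∈ (p ∷ P) e) refl)

  Unique-prefix : ∀ (xs ys : List A) → Unique (xs ++ ys) → Unique xs
  Unique-prefix [] ys u = []
  Unique-prefix (x ∷ xs) ys (a ∷ u) = ++⁻ˡ xs a ∷ Unique-prefix xs ys u

  Unique-across : ∀ (xs ys : List A) {a b} → Unique (xs ++ ys) → a ∈ xs → b ∈ ys → a ≢ b
  Unique-across (x ∷ xs) ys (p ∷ _) (here refl) m = All.lookup p (++⁺ʳ xs m)
  Unique-across (x ∷ xs) ys (_ ∷ p) (there m') m = Unique-across xs ys p m' m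

  Infix₃ : A → A → A → List A → Set
  Infix₃ a b c L = Σ (List A) λ P → Σ (List A) λ Q → L ≡ P ++ a ∷ b ∷ c ∷ Q

  Infix₃-reverse : ∀ {a b c} L → Infix₃ a b c L → Infix₃ c b a (reverse L)
  Infix₃-reverse {a} {b} {c} L (P , Q , refl) = reverse Q , reverse P , (begin
    reverse (P ++ a ∷ b ∷ c ∷ Q)               ≡⟨ reverse-++ P (a ∷ b ∷ c ∷ Q) ⟩
    reverse (a ∷ b ∷ c ∷ Q) ++ reverse P       ≡⟨ cong (_++ reverse P) (reverse-∷∷∷ a b c Q) ⟩
    (reverse Q ++ c ∷ b ∷ a ∷ []) ++ reverse P ≡⟨ ++-assoc (reverse Q) (c ∷ b ∷ a ∷ []) (reverse P) ⟩
    reverse Q ++ c ∷ b ∷ a ∷ reverse P         ∎)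
    where open ≡-Reasoning

  Chain₃-infix : ∀ {R a b c} L → Chain₃ R L → Infix₃ a b c L → R a b c
  Chain₃-infix L ch (P , Q , refl) = proj₁ (Chain₃-suffix P _ ch)

  Infix₃-split : ∀ {a b c} X t Y → Infix₃ a b c (X ++ t ∷ Y) → b ≢ t →
                 Infix₃ a b c (X ++ t ∷ []) ⊎ Infix₃ a b c (t ∷ Y)
  Infix₃-split [] t Y (P , Q , e) ne = inj₂ (P , Q , e)
  Infix₃-split {a} {b} {c} (x ∷ X) t Y ([] , Q , e) ne = atHead X e
    where
    atHead : ∀ X → x ∷ X ++ t ∷ Y ≡ a ∷ b ∷ c ∷ Q → Infix₃ a b c (x ∷ X ++ t ∷ []) ⊎ Infix₃ a b c (t ∷ Y)
    atHead [] refl = ⊥-elim (ne refl)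
    atHead (x' ∷ []) refl = inj₁ ([] , [] , refl)
    atHead (x' ∷ x'' ∷ X) refl = inj₁ ([] , X ++ t ∷ [] , refl)
  Infix₃-split (x ∷ X) t Y (p ∷ P , Q , e) ne with Infix₃-split X t Y (P , Q , proj₂ (∷-injective e)) ne
  ... | inj₁ (P' , Q' , e') = inj₁ (x ∷ P' , Q' , cong (x ∷_) e')
  ... | inj₂ i = inj₂ i

  -- glue X' g j d Y' joins the sequences j g X' and j d Y' at j, reading the
  -- first backwards
  glue : List A → A → A → A → List A → List A
  glue X' g j d Y' = reverse X' ++ g ∷ j ∷ d ∷ Y'

  Chain-glue : ∀ {R} → (∀ {x y} → R x y → R y x) → ∀ X' g j d Y' →
               Chain R (j ∷ g ∷ X') → Chain R (j ∷ d ∷ Y') → Chain R (glue X' g j d Y')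
  Chain-glue {R} s X' g j d Y' cx cy = Chain-++ (reverse X') g (j ∷ d ∷ Y')
    (subst (Chain R) (unfold-reverse g X') (Chain-reverse s (g ∷ X') (proj₂ cx))) (s (proj₁ cx) , cy)

  Chain₃-glue : ∀ {R} → (∀ {x y z} → R x y z → R z y x) → ∀ X' g j d Y' →
                Chain₃ R (j ∷ g ∷ X') → Chain₃ R (j ∷ d ∷ Y') → R g j d → Chain₃ R (glue X' g j d Y')
  Chain₃-glue {R} s X' g j d Y' cx cy r = Chain₃-++ (reverse X') g j (d ∷ Y')
    (subst (Chain₃ R) (reverse-∷∷ j g X') (Chain₃-reverse s (j ∷ g ∷ X') cx)) (r , cy)

  glue-ends : ∀ X' g j d Y' → Σ (List A) λ K →
              glue X' g j d Y' ≡ final g X' ∷ K × final (final g X') K ≡ final d Y'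
  glue-ends X' g j d Y' with reverse-final g X'
  ... | K' , e = K' ++ j ∷ d ∷ Y' ,
    trans (sym (++-assoc (reverse X') (g ∷ []) (j ∷ d ∷ Y'))) (cong (_++ j ∷ d ∷ Y') e) ,
    final-++ (final g X') K' j (d ∷ Y')

module _ {n : ℕ} (T : LabeledTree n) where
  open LabeledTree T

  record DiamondLeaves : Set where
    constructor diamondLeaves
    field
      a b c d : Fin n
      leaf-a  : Leaf a
      leaf-b  : Leaf b
      leaf-c  : Leaf c
      leaf-d  : Leaf d
      a≢b     : a ≢ b
      a≢c     : a ≢ c
      a≢d     : a ≢ d
      b≢c     : b ≢ c
      b≢d     : b ≢ d
      c≢d     : c ≢ d
      path-ab : AltPath (lf a) (lf b)
      path-ac : AltPath (lf a) (lf c)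
      path-ad : AltPath (lf a) (lf d)
      path-bc : AltPath (lf b) (lf c)
      path-bd : AltPath (lf b) (lf d)
      ¬path-cd : ¬ AltPath (lf c) (lf d)

module SplitTree {n : ℕ} (T : LabeledTree n) (RT : LabeledTree.IsReducedCliqueStar T) where

  open ListFacts
  open LabeledTree T

  HasCycle : Set
  HasCycle = Σ (List (Fin n)) λ cyc → 3 ≤ length cyc × AllPairs _≢_ cyc ×
    Linked (λ x y → tadj x y ≡ true) cyc ×
    Σ (Fin n) λ f → Σ (Fin n) λ l →
      (Data.List.head cyc ≡ just f) × (last cyc ≡ just l) × tadj l f ≡ true

  acyclic : ¬ HasCycle
  acyclic = proj₂ (proj₁ RT)

  internal⇒deg≥3 : ∀ v → Internal v → 3 ≤ deg v
  internal⇒deg≥3 = proj₁ (proj₂ RT)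

  clique-or-star : ∀ v → Internal v → CliqueNode v ⊎ StarNode v
  clique-or-star = proj₁ (proj₂ (proj₂ RT))

  Adj : Fin n → Fin n → Set
  Adj x y = tadj x y ≡ true

  adj-sym : ∀ {x y} → Adj x y → Adj y x
  adj-sym {x} {y} e = trans (tsym y x) e

  adj-irrefl : ∀ {x} → ¬ Adj x x
  adj-irrefl {x} e with trans (sym (tirrefl x)) e
  ... | ()

  NoBacktrack : Fin n → Fin n → Fin n → Set
  NoBacktrack x _ z = x ≢ z

  Walk : List (Fin n) → Set
  Walk L = Chain Adj L × Chain₃ NoBacktrack L

  walk-tail : ∀ x L → Walk (x ∷ L) → Walk L
  walk-tail x L (l , b) = Chain-tail x L l , Chain₃-tail x L b

  walk-reverse : ∀ xs → Walk xs → Walk (reverse xs)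
  walk-reverse xs (l , b) = Chain-reverse adj-sym xs l , Chain₃-reverse (λ ne e → ne (sym e)) xs b

  walk-glue : ∀ X' g j d Y' → Walk (j ∷ g ∷ X') → Walk (j ∷ d ∷ Y') → g ≢ d → Walk (glue X' g j d Y')
  walk-glue X' g j d Y' (lx , nx) (ly , ny) ne =
    Chain-glue adj-sym X' g j d Y' lx ly , Chain₃-glue (λ ne' e → ne' (sym e)) X' g j d Y' nx ny ne

  -- a walk leaving x never returns to x, since the detour would close a cycle
  walk-avoids-start : ∀ x y r → Adj x y → Chain₃ NoBacktrack (x ∷ y ∷ r) → Unique (y ∷ r) →
                      Chain Adj (y ∷ r) → x ∈ y ∷ r → ⊥
  walk-avoids-start x y r a nb u lk mem with ∈-∃++ mem
  ... | [] , post , refl = adj-irrefl a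
  ... | y' ∷ [] , post , refl = proj₁ nb refl
  ... | y' ∷ z ∷ pre , post , eq with refl ← eq =
    acyclic (cyc , len , Unique-prefix cyc post (subst Unique split u) ,
             Chain⇒Linked cyc (Chain-prefix cyc post (subst (Chain Adj) split lk)) ,
             y , x , refl , last-cyc , a)
    where
    cyc : List (Fin n)
    cyc = y ∷ z ∷ pre ++ x ∷ []
    split : y ∷ z ∷ pre ++ x ∷ post ≡ cyc ++ post
    split = cong (λ w → y ∷ z ∷ w) (sym (++-assoc pre (x ∷ []) post))
    len : 3 ≤ length cyc
    len rewrite length-++-sucʳ pre x [] = s≤s (s≤s (s≤s z≤n))
    last-cyc : last cyc ≡ just x
    last-cyc = trans (last-final y (z ∷ pre ++ x ∷ [])) (cong just (final-++ z pre x []))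

  walk⇒Unique : ∀ L → Walk L → Unique L
  walk⇒Unique [] _ = []
  walk⇒Unique (x ∷ []) _ = [] ∷ []
  walk⇒Unique (x ∷ y ∷ r) ((a , lk) , nb) =
    avoids (walk⇒Unique (y ∷ r) (lk , Chain₃-tail x (y ∷ r) nb))
    where
    avoids : Unique (y ∷ r) → Unique (x ∷ y ∷ r)
    avoids u = All.tabulate (λ m eq → walk-avoids-start x y r a nb u lk (subst (_∈ y ∷ r) (sym eq) m)) ∷ u

  walk-determined : ∀ x P Q → Walk (x ∷ P) → Walk (x ∷ Q) → last (x ∷ P) ≡ last (x ∷ Q) → P ≡ Q
  walk-determined x [] [] wp wq e = refl
  walk-determined x [] (q ∷ Q) wp wq e with Unique-last-head x (q ∷ Q) (walk⇒Unique _ wq) (sym e)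
  ... | ()
  walk-determined x (p ∷ P) [] wp wq e with Unique-last-head x (p ∷ P) (walk⇒Unique _ wp) e
  ... | ()
  walk-determined x (p ∷ P) (q ∷ Q) wp wq e with p ≟F q
  ... | yes refl = cong (p ∷_) (walk-determined p P Q (walk-tail x _ wp) (walk-tail x _ wq) e)
  ... | no p≢q = ⊥-elim (Unique-across (reverse P ++ p ∷ []) (x ∷ q ∷ Q) u endP endQ refl)
    where
    -- otherwise the two walks glue to a closed walk through x
    u : Unique ((reverse P ++ p ∷ []) ++ x ∷ q ∷ Q)
    u = subst Unique (sym (++-assoc (reverse P) (p ∷ []) (x ∷ q ∷ Q)))
          (walk⇒Unique _ (walk-glue P p x q Q wp wq p≢q))
    endP : final p P ∈ reverse P ++ p ∷ []
    endP = subst (final p P ∈_) (unfold-reverse p P) (reverse⁺ (final-∈ p P))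
    endQ : final p P ∈ x ∷ q ∷ Q
    endQ = there (last-∈ (q ∷ Q) (trans (sym e) (last-final p P)))

  lookup-injective : ∀ (xs : List (Fin n)) → Unique xs → ∀ {i j} → lookup xs i ≡ lookup xs j → i ≡ j
  lookup-injective (x ∷ xs) u {zero} {zero} e = refl
  lookup-injective (x ∷ xs) (a ∷ u) {zero} {suc j} e = ⊥-elim (All.lookup a (∈-lookup j) e)
  lookup-injective (x ∷ xs) (a ∷ u) {suc i} {zero} e = ⊥-elim (All.lookup a (∈-lookup i) (sym e))
  lookup-injective (x ∷ xs) (a ∷ u) {suc i} {suc j} e = cong suc (lookup-injective xs u e)

  Unique-length : ∀ (xs : List (Fin n)) → Unique xs → length xs ≤ n
  Unique-length xs u = injective⇒≤ {f = lookup xs} (lookup-injective xs u)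

  neighbours : Fin n → List (Fin n)
  neighbours v = filterᵇ (tadj v) (allFin n)

  ∈-neighbours : ∀ {v a} → Adj v a → a ∈ neighbours v
  ∈-neighbours {v} {a} e = ∈-filter⁺ (T? ∘ tadj v) (∈-allFin a) (Equivalence.from T-≡ e)

  neighbours-adj : ∀ {v a} → a ∈ neighbours v → Adj v a
  neighbours-adj {v} m = Equivalence.to T-≡ (proj₂ (∈-filter⁻ (T? ∘ tadj v) {xs = allFin n} m))

  two-neighbours⇒internal : ∀ {v a b} → Adj v a → Adj v b → a ≢ b → Internal v
  two-neighbours⇒internal {v} ea eb ne = atLeastTwo (neighbours v) (∈-neighbours ea) (∈-neighbours eb) ne
    where
    atLeastTwo : ∀ xs {a b : Fin n} → a ∈ xs → b ∈ xs → a ≢ b → 2 ≤ length xs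
    atLeastTwo (x ∷ []) (here refl) (here refl) ne = ⊥-elim (ne refl)
    atLeastTwo (x ∷ y ∷ xs) _ _ _ = s≤s (s≤s z≤n)

  leaf-not-internal : ∀ {v} → Leaf v → ¬ Internal v
  leaf-not-internal l i with ≤-trans i l
  ... | s≤s ()

  leaf-unique-neighbour : ∀ {v a b} → Leaf v → Adj v a → Adj v b → a ≡ b
  leaf-unique-neighbour {v} {a} {b} l ea eb with a ≟F b
  ... | yes e = e
  ... | no ne = ⊥-elim (leaf-not-internal l (two-neighbours⇒internal ea eb ne))

  record OtherPair (v c : Fin n) : Set where
    field
      e₁ e₂ : Fin n
      adj₁  : Adj v e₁
      adj₂  : Adj v e₂
      e₁≢e₂ : e₁ ≢ e₂
      e₁≢c  : e₁ ≢ c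
      e₂≢c  : e₂ ≢ c

  -- an internal node has degree ≥ 3, so besides c it has two more neighbours
  other-pair : ∀ v c → Internal v → OtherPair v c
  other-pair v c iv with three (neighbours v) (internal⇒deg≥3 v iv) (Unique.filter⁺ (T? ∘ tadj v) (Unique.allFin⁺ n))
    where
    three : ∀ xs → 3 ≤ length xs → Unique xs → Σ (Fin n) λ x → Σ (Fin n) λ y → Σ (Fin n) λ z →
            x ∈ xs × y ∈ xs × z ∈ xs × x ≢ y × x ≢ z × y ≢ z
    three (x ∷ y ∷ z ∷ _) (s≤s (s≤s (s≤s _))) (px ∷ py ∷ _) =
      x , y , z , here refl , there (here refl) , there (there (here refl)) ,
      All.lookup px (here refl) , All.lookup px (there (here refl)) , All.lookup py (here refl)
  ... | x , y , z , mx , my , mz , x≢y , x≢z , y≢z with c ≟F x | c ≟F y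
  ... | yes refl | _ = record { e₁ = y ; e₂ = z ; adj₁ = neighbours-adj my ; adj₂ = neighbours-adj mz
                             ; e₁≢e₂ = y≢z ; e₁≢c = x≢y ∘ sym ; e₂≢c = x≢z ∘ sym }
  ... | no c≢x | yes refl = record { e₁ = x ; e₂ = z ; adj₁ = neighbours-adj mx ; adj₂ = neighbours-adj mz
                                   ; e₁≢e₂ = x≢z ; e₁≢c = x≢y ; e₂≢c = y≢z ∘ sym }
  ... | no c≢x | no c≢y = record { e₁ = x ; e₂ = y ; adj₁ = neighbours-adj mx ; adj₂ = neighbours-adj my
                                 ; e₁≢e₂ = x≢y ; e₁≢c = c≢x ∘ sym ; e₂≢c = c≢y ∘ sym }

  Turn : Fin n → Fin n → Fin n → Set
  Turn x y z = lab y x z ≡ true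

  Good : List (Fin n) → Set
  Good = Chain₃ Turn

  turn-sym : ∀ {x y z} → Turn x y z → Turn z y x
  turn-sym {x} {y} {z} e = trans (lsym y z x) e

  good-reverse : ∀ xs → Good xs → Good (reverse xs)
  good-reverse = Chain₃-reverse turn-sym

  good-glue : ∀ X' g j d Y' → Good (j ∷ g ∷ X') → Good (j ∷ d ∷ Y') → Turn g j d → Good (glue X' g j d Y')
  good-glue = Chain₃-glue turn-sym

  record GoodWalk (x y : Fin n) : Set where
    constructor goodWalk
    field
      route : List (Fin n)
      walk  : Walk (x ∷ route)
      good  : Good (x ∷ route)
      ends  : final x route ≡ y

  record Branch (j g ℓ : Fin n) : Set where
    constructor branch
    field
      route : List (Fin n)
      walk  : Walk (j ∷ g ∷ route)
      good  : Good (j ∷ g ∷ route)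
      ends  : final g route ≡ ℓ
      leaf  : Leaf ℓ

  -- entering an internal node w from p, the walk can continue with a turn:
  -- in a clique any other marker works, in a star the center or any marker
  -- if p is the center
  next-marker : ∀ p w → Adj w p → Internal w → Σ (Fin n) λ q → Adj w q × p ≢ q × Turn p w q
  next-marker p w awp iw with clique-or-star w iw | other-pair w p iw
  ... | inj₁ (_ , clique) | o = e₁ , adj₁ , e₁≢c ∘ sym , clique p e₁ awp adj₁ (e₁≢c ∘ sym)
    where open OtherPair o
  ... | inj₂ (κ , (_ , aκ , center , _)) | o with p ≟F κ
  ... | yes refl = e₁ , adj₁ , e₁≢c ∘ sym , center e₁ adj₁ e₁≢c
    where open OtherPair o
  ... | no p≢κ = κ , aκ , p≢κ , trans (lsym w p κ) (center p awp p≢κ)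

  -- iterating next-marker reaches a leaf; the fuel is justified because a
  -- walk visits at most n nodes
  extend-to-leaf : ∀ fuel past p w → Walk (w ∷ p ∷ past) → n < fuel + length (w ∷ p ∷ past) →
                   Σ (Fin n) (Branch p w)
  extend-to-leaf zero past p w W n<len = ⊥-elim (<⇒≱ n<len (Unique-length _ (walk⇒Unique _ W)))
  extend-to-leaf (suc fuel) past p w W@((awp , _) , _) n<len with deg w ≤? 1
  ... | yes leaf = w , branch [] ((adj-sym awp , tt) , tt) tt refl leaf
  ... | no ¬leaf with next-marker p w awp (≰⇒> ¬leaf)
  ... | q , awq , p≢q , turn with extend-to-leaf fuel (p ∷ past) w q
                                  ((adj-sym awq , proj₁ W) , (p≢q ∘ sym , proj₂ W))
                                  (subst (n <_) (sym (+-suc fuel _)) n<len)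
  ... | ℓ , branch L (lk , nb) g e leaf = ℓ , branch (q ∷ L) ((adj-sym awp , lk) , (p≢q , nb)) (turn , g) e leaf

  to-leaf : ∀ p w → Adj p w → Σ (Fin n) (Branch p w)
  to-leaf p w a = extend-to-leaf (suc n) [] p w ((adj-sym a , tt) , tt) (s≤s (m≤m+n n 2))

  node : AuxV → Fin n
  node (lf x) = x
  node (mk v a) = v

  mk-injectiveˡ : ∀ {v a w b} → mk v a ≡ mk w b → v ≡ w
  mk-injectiveˡ refl = refl

  mk-injectiveʳ : ∀ {v a w b} → mk v a ≡ mk w b → a ≡ b
  mk-injectiveʳ refl = refl

  end-node : ∀ {v w x} → End v w x → node x ≡ v
  end-node (leafEnd _) = refl
  end-node (markEnd _) = refl

  end-unique : ∀ {v w x y} → End v w x → End v w y → x ≡ y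
  end-unique (leafEnd _) (leafEnd _) = refl
  end-unique (leafEnd l) (markEnd i) = ⊥-elim (leaf-not-internal l i)
  end-unique (markEnd i) (leafEnd l) = ⊥-elim (leaf-not-internal l i)
  end-unique (markEnd _) (markEnd _) = refl

  end-edge-unique : ∀ {w p v' w' y} → End w p y → End v' w' y → Adj w p → Adj v' w' → p ≡ w'
  end-edge-unique (leafEnd l) (leafEnd _) a a' = leaf-unique-neighbour l a a'
  end-edge-unique (markEnd _) (markEnd _) a a' = refl

  interior-source : ∀ {v s t} → InteriorAt v (s , t) → node s ≡ v
  interior-source (a , b , refl , _) = refl

  interior-target : ∀ {v s t} → InteriorAt v (s , t) → node t ≡ v
  interior-target (a , b , _ , refl) = refl

  -- Realises V L: the auxiliary path V follows the walk L, taking the tree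
  -- edge of each step of L and crossing each inner node w of L by the
  -- interior edge of G_w between the markers of the incoming and outgoing edges
  data Realises : List AuxV → List (Fin n) → Set where
    edge    : ∀ {p w x y} → Adj p w → End p w x → End w p y → Realises (x ∷ y ∷ []) (p ∷ w ∷ [])
    through : ∀ {p w q x V L} → Adj p w → End p w x → Internal w → p ≢ q → Turn p w q →
              Realises (mk w q ∷ V) (w ∷ q ∷ L) → Realises (x ∷ mk w p ∷ mk w q ∷ V) (p ∷ w ∷ q ∷ L)

  realises-adj : ∀ {V p w L} → Realises V (p ∷ w ∷ L) → Adj p w
  realises-adj (edge a _ _) = a
  realises-adj (through a _ _ _ _ _) = a

  realises-good-walk : ∀ {V L} → Realises V L → Walk L × Good L
  realises-good-walk (edge a _ _) = ((a , tt) , tt) , tt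
  realises-good-walk (through a _ _ ne t r) with realises-good-walk r
  ... | (lk , nb) , g = ((a , lk) , (ne , nb)) , (t , g)

  realises-edges : ∀ {V L} → Realises V L → Linked AuxEdge V
  realises-edges (edge a e₁ e₂) = treeEdge a e₁ e₂ ∷ [-]
  realises-edges (through a e₁ iw ne t r) =
    treeEdge a e₁ (markEnd iw) ∷ interior (iw , adj-sym a) (iw , realises-adj r) ne t ∷ realises-edges r

  realises-nodes : ∀ {x V p L} → Realises (x ∷ V) (p ∷ L) → node x ≡ p × All (λ y → node y ∈ L) V
  realises-nodes (edge a e₁ e₂) = end-node e₁ , (here (end-node e₂) ∷ [])
  realises-nodes (through a e₁ iw ne t r) =
    end-node e₁ , here refl ∷ here refl ∷ All.map there (proj₂ (realises-nodes r))

  realises-unique : ∀ {V L} → Realises V L → Unique L → Unique V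
  realises-unique (edge a e₁ e₂) u =
    ((λ eq → adj-irrefl (subst (λ z → Adj z _) (trans (sym (end-node e₁)) (trans (cong node eq) (end-node e₂))) a)) ∷ [])
    ∷ [] ∷ []
  realises-unique {x ∷ mk w p ∷ mk w q ∷ V} {p ∷ w ∷ q ∷ L} (through a e₁ iw ne t r) (up ∷ uw ∷ u) =
    All.tabulate (λ m eq → All.lookup up (All.lookup laterNodes m) (trans (sym (end-node e₁)) (cong node eq)))
    ∷ ((λ eq → ne (mk-injectiveʳ eq)) ∷ All.tabulate (λ m eq → All.lookup uw (All.lookup rest m) (cong node eq)))
    ∷ realises-unique r (uw ∷ u)
    where
    rest : All (λ y → node y ∈ q ∷ L) V
    rest = proj₂ (realises-nodes r)
    laterNodes : All (λ y → node y ∈ w ∷ q ∷ L) (mk w p ∷ mk w q ∷ V)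
    laterNodes = here refl ∷ here refl ∷ All.map there rest

  Alternating : List (AuxV × AuxV) → Set
  Alternating [] = ⊤
  Alternating (s ∷ ss) = (∀ v → InteriorAt v s → All (λ t → ¬ InteriorAt v t) ss) × Alternating ss

  All-at : ∀ {A : Set} {P : A → Set} {xs} → All P xs → ∀ i → P (lookup xs i)
  All-at p i = All.lookup p (∈-lookup i)

  All-from-indices : ∀ {A : Set} {P : A → Set} xs → (∀ i → P (lookup xs i)) → All P xs
  All-from-indices [] f = []
  All-from-indices (x ∷ xs) f = f zero ∷ All-from-indices xs (f ∘ suc)

  AltIndexed : List (AuxV × AuxV) → Set
  AltIndexed ss = ∀ v (i j : Fin (length ss)) →
    InteriorAt v (lookup ss i) → InteriorAt v (lookup ss j) → i ≡ j

  alternating⇒indexed : ∀ ss → Alternating ss → AltIndexed ss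
  alternating⇒indexed (s ∷ ss) a v zero zero p q = refl
  alternating⇒indexed (s ∷ ss) a v zero (suc j) p q = ⊥-elim (All-at (proj₁ a v p) j q)
  alternating⇒indexed (s ∷ ss) a v (suc i) zero p q = ⊥-elim (All-at (proj₁ a v q) i p)
  alternating⇒indexed (s ∷ ss) a v (suc i) (suc j) p q = cong suc (alternating⇒indexed ss (proj₂ a) v i j p q)

  indexed⇒alternating : ∀ ss → AltIndexed ss → Alternating ss
  indexed⇒alternating [] f = tt
  indexed⇒alternating (s ∷ ss) f =
    (λ v p → All-from-indices ss (λ j q → zero≢suc (f v zero (suc j) p q))) ,
    indexed⇒alternating ss (λ v i j p q → suc-injective (f v (suc i) (suc j) p q))
    where
    zero≢suc : ∀ {m} {j : Fin m} → Fin.zero {m} ≢ suc j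
    zero≢suc ()

  All-targets : ∀ {P : AuxV → Set} y V → All P V → All (λ st → P (proj₂ st)) (steps (y ∷ V))
  All-targets y [] _ = []
  All-targets y (z ∷ V) (p ∷ ps) = p ∷ All-targets z V ps

  -- along a path (a unique walk) every node is crossed at most once
  realises-alternating : ∀ {V L} → Realises V L → Unique L → Alternating (steps V)
  realises-alternating (edge a e₁ e₂) u = (λ v _ → []) , tt
  realises-alternating {x ∷ mk w p ∷ mk w q ∷ V} {p ∷ w ∷ q ∷ L} (through a e₁ iw ne t r) (up ∷ uw ∷ u) =
    (λ v ia → ⊥-elim (All.lookup up (here refl)
                (trans (sym (end-node e₁)) (trans (interior-source ia) (sym (interior-target ia)))))) ,
    (λ v ia → All.map (λ nq ia' → nq (trans (interior-target ia') (sym (interior-target ia))))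
                (All-targets {λ y → node y ≢ w} (mk w q) V (All.map (λ m eq → All.lookup uw m (sym eq)) rest))) ,
    realises-alternating r (uw ∷ u)
    where
    rest : All (λ y → node y ∈ q ∷ L) V
    rest = proj₂ (realises-nodes r)

  realises-avoids-first : ∀ {x V p L} → Realises (x ∷ V) (p ∷ L) → Unique (p ∷ L) →
                          All (λ st → ¬ InteriorAt p st) (steps (x ∷ V))
  realises-avoids-first {x} {V} r (up ∷ _) =
    All.map (λ ne ia → ne (interior-target ia))
      (All-targets {λ y → node y ≢ _} x V (All.map (λ m eq → All.lookup up m (sym eq)) (proj₂ (realises-nodes r))))

  realises-avoids-final : ∀ {V p L} → Realises V (p ∷ L) → Unique (p ∷ L) →
                          All (λ st → ¬ InteriorAt (final p L) st) (steps V)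
  realises-avoids-final (edge a e₁ e₂) u =
    (λ ia → adj-irrefl (subst (λ z → Adj z _) (trans (sym (end-node e₁)) (interior-source ia)) a)) ∷ []
  realises-avoids-final {p = p} {w ∷ q ∷ L} (through a e₁ iw ne t r) (up ∷ uw ∷ u) =
    (λ ia → All.lookup up (final-∈ w (q ∷ L)) (trans (sym (end-node e₁)) (interior-source ia))) ∷
    (λ ia → All.lookup uw (final-∈ q L) (interior-source ia)) ∷
    realises-avoids-final r (uw ∷ u)

  EndsAt : AuxV → List (Fin n) → Set
  EndsAt y (q ∷ r ∷ []) = End r q y
  EndsAt y (q ∷ r ∷ s ∷ L) = EndsAt y (r ∷ s ∷ L)
  EndsAt y _ = ⊥

  EndsAt-++ : ∀ y P a b Q → EndsAt y (a ∷ b ∷ Q) → EndsAt y (P ++ a ∷ b ∷ Q)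
  EndsAt-++ y [] a b Q e = e
  EndsAt-++ y (x ∷ P) a b Q e = cons x (P ++ a ∷ b ∷ Q) (EndsAt-++ y P a b Q e)
    where
    cons : ∀ x M → EndsAt y M → EndsAt y (x ∷ M)
    cons x (z ∷ m ∷ M) e = e

  EndsAt-leaf : ∀ B a b Q → Leaf B → final b Q ≡ B → EndsAt (lf B) (a ∷ b ∷ Q)
  EndsAt-leaf B a b [] l refl = leafEnd l
  EndsAt-leaf B a b (c ∷ Q) l e = EndsAt-leaf B b c Q l e

  EndsAt-last : ∀ y L → EndsAt y L →
                Σ (List (Fin n)) λ pre → Σ (Fin n) λ q → Σ (Fin n) λ r → L ≡ pre ++ q ∷ r ∷ [] × End r q y
  EndsAt-last y (q ∷ r ∷ []) e = [] , q , r , refl , e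
  EndsAt-last y (q ∷ r ∷ s ∷ L) e with EndsAt-last y (r ∷ s ∷ L) e
  ... | pre , q' , r' , eq , e' = q ∷ pre , q' , r' , cong (q ∷_) eq , e'

  realises-EndsAt : ∀ {x ws L} → Realises (x ∷ ws) L → EndsAt (final x ws) L
  realises-EndsAt (edge a e₁ e₂) = e₂
  realises-EndsAt (through a e₁ iw ne t r) = realises-EndsAt r

  realisation : ∀ p w L x y → End p w x → Walk (p ∷ w ∷ L) → Good (p ∷ w ∷ L) → EndsAt y (p ∷ w ∷ L) →
                Σ (List AuxV) λ ws → Realises (x ∷ ws) (p ∷ w ∷ L) × last (x ∷ ws) ≡ just y
  realisation p w [] x y ex ((a , _) , _) _ ey = y ∷ [] , edge a ex ey , refl
  realisation p w (q ∷ L) x y ex ((a , lk) , (ne , nb)) (t , g) ey =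
    mk w p ∷ mk w q ∷ proj₁ rest , through a ex iw ne t (proj₁ (proj₂ rest)) , proj₂ (proj₂ rest)
    where
    iw : Internal w
    iw = two-neighbours⇒internal (adj-sym a) (proj₁ lk) ne
    rest : Σ (List AuxV) λ ws → Realises (mk w q ∷ ws) (w ∷ q ∷ L) × last (mk w q ∷ ws) ≡ just y
    rest = realisation w q L (mk w q) y (markEnd iw) (lk , nb) g ey

  realise-good-walk : ∀ p w L x y → End p w x → Walk (p ∷ w ∷ L) → Good (p ∷ w ∷ L) → EndsAt y (p ∷ w ∷ L) →
                       Σ (AltPath x y) λ P → Realises (x ∷ AltPath.ws P) (p ∷ w ∷ L)
  realise-good-walk p w L x y ex W G ey with realisation p w L x y ex W G ey
  ... | ws , r , e = record { ws = ws ; ends = e ; distinct = realises-unique r (walk⇒Unique _ W)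
                            ; edges = realises-edges r
                            ; alt = alternating⇒indexed (steps (x ∷ ws)) (realises-alternating r (walk⇒Unique _ W)) } , r

  FirstStepTree : AuxV → List AuxV → Set
  FirstStepTree x [] = ⊤
  FirstStepTree x (y ∷ _) = ∀ v → ¬ InteriorAt v (x , y)

  LastStepTree : List AuxV → Set
  LastStepTree (x ∷ y ∷ []) = ∀ v → ¬ InteriorAt v (x , y)
  LastStepTree (x ∷ y ∷ z ∷ r) = LastStepTree (y ∷ z ∷ r)
  LastStepTree _ = ⊤

  last-step-tree : ∀ {Q : AuxV × AuxV → Set} {e} V → last V ≡ just e → All Q (steps V) →
                   (∀ s v → InteriorAt v (s , e) → ¬ Q (s , e)) → LastStepTree V
  last-step-tree (x ∷ []) le aq h = tt
  last-step-tree (x ∷ y ∷ []) refl (q ∷ []) h = λ v ia → h x v ia q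
  last-step-tree (x ∷ y ∷ z ∷ r) le (_ ∷ aq) h = last-step-tree (y ∷ z ∷ r) le aq h

  -- conversely an alternated path starting with a tree edge p w and ending
  -- with a tree edge realises a walk p w …: after a tree edge into a node the
  -- path must leave through one interior edge followed by a tree edge
  realises-from-edge : ∀ {p w} x y r → Adj p w → End p w x → End w p y → Linked AuxEdge (y ∷ r) →
                       Unique (x ∷ y ∷ r) → Alternating (steps (y ∷ r)) → LastStepTree (x ∷ y ∷ r) →
                       Σ (List (Fin n)) λ L → Realises (x ∷ y ∷ r) (p ∷ w ∷ L)
  realises-from-edge x y [] a ex ey lk ds al ls = [] , edge a ex ey
  realises-from-edge {p} {w} x y (z ∷ r') a ex ey (treeEdge {v'} {w'} a' e₁ e₂ ∷ lk') (dx ∷ _) al ls =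
    -- two tree edges in a row would return to x
    ⊥-elim (All.lookup dx (there (here refl)) (end-unique ex e₂'))
    where
    e₂' : End p w z
    e₂' = subst₂ (λ A B → End A B z) (sym (end-edge-unique ey e₁ (adj-sym a) a'))
                 (trans (sym (end-node e₁)) (end-node ey)) e₂
  realises-from-edge x (mk w p) (mk w b ∷ []) a ex (markEnd iw) (interior ma mb ne l ∷ lk') ds al ls =
    ⊥-elim (ls w (p , b , refl , refl))
  realises-from-edge x (mk w p) (mk w b ∷ z' ∷ r'') a ex (markEnd iw)
                     (interior ma mb ne l ∷ interior ma' mb' ne' l' ∷ lk'') ds al ls =
    ⊥-elim (All.lookup (proj₁ al w (p , b , refl , refl)) (here refl) (_ , _ , refl , refl))
  realises-from-edge x (mk w p) (mk w b ∷ z' ∷ r'') a ex (markEnd iw)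
                     (interior ma mb ne l ∷ treeEdge a₃ (markEnd iw₃) e₄ ∷ lk'') (_ ∷ _ ∷ ds) al ls
    with realises-from-edge (mk w b) z' r'' a₃ (markEnd iw₃) e₄ lk'' ds (proj₂ (proj₂ al)) ls
  ... | L' , rec = b ∷ L' , through a ex iw ne l rec

  alt-path⇒realises : ∀ {x y} (P : AltPath x y) → x ≢ y → FirstStepTree x (AltPath.ws P) → LastStepTree (x ∷ AltPath.ws P) →
                      Σ (Fin n) λ p → Σ (Fin n) λ w → Σ (List (Fin n)) λ L → End p w x × Realises (x ∷ AltPath.ws P) (p ∷ w ∷ L)
  alt-path⇒realises record { ws = [] ; ends = refl } ne fs ls = ⊥-elim (ne refl)
  alt-path⇒realises record { ws = y₁ ∷ r ; edges = interior {v} {a} {b} _ _ _ _ ∷ lk } ne fs ls =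
    ⊥-elim (fs v (a , b , refl , refl))
  alt-path⇒realises {x} record { ws = y₁ ∷ r ; distinct = ds ; edges = treeEdge {p} {w} a ex ey ∷ lk ; alt = al } ne fs ls
    with realises-from-edge x y₁ r a ex ey lk ds (proj₂ (indexed⇒alternating (steps (x ∷ y₁ ∷ r)) al)) ls
  ... | L , rz = p , w , L , ex , rz

  final-of-path : ∀ {x y} (P : AltPath x y) → final x (AltPath.ws P) ≡ y
  final-of-path {x} P = just-injective (trans (sym (last-final x (AltPath.ws P))) (AltPath.ends P))

  good-walk⇒leaf-path : ∀ {A B} → GoodWalk A B → Leaf A → Leaf B → A ≢ B → AltPath (lf A) (lf B)
  good-walk⇒leaf-path (goodWalk [] W G e) lA lB A≢B = ⊥-elim (A≢B e)
  good-walk⇒leaf-path {A} (goodWalk (k ∷ K) W G refl) lA lB A≢B =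
    proj₁ (realise-good-walk A k K (lf A) (lf (final k K)) (leafEnd lA) W G (EndsAt-leaf _ A k K lB refl))

  leaf-first-step : ∀ A ws → FirstStepTree (lf A) ws
  leaf-first-step A [] = tt
  leaf-first-step A (y ∷ ws) v (_ , _ , () , _)

  not-interior-into-leaf : ∀ {B s v} → ¬ InteriorAt v (s , lf B)
  not-interior-into-leaf (_ , _ , _ , ())

  end-at-leaf : ∀ {r q y B} → End r q y → y ≡ lf B → r ≡ B
  end-at-leaf (leafEnd _) refl = refl

  leaf-path⇒good-walk : ∀ {A B} → AltPath (lf A) (lf B) → A ≢ B → GoodWalk A B
  leaf-path⇒good-walk {A} {B} P A≢B
    with alt-path⇒realises P (A≢B ∘ cong node) (leaf-first-step A (AltPath.ws P))
           (last-step-tree {Q = λ _ → ⊤} (lf A ∷ AltPath.ws P) (AltPath.ends P) (All.tabulate (λ _ → tt))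
              (λ s v ia _ → not-interior-into-leaf ia))
  ... | p , w , L , ex , rz = subst (λ z → GoodWalk z B) (sym (end-node ex)) (walk-of rz)
    where
    walk-of : Realises (lf A ∷ AltPath.ws P) (p ∷ w ∷ L) → GoodWalk p B
    walk-of rz with EndsAt-last _ _ (realises-EndsAt rz)
    ... | pre , q , r , eq , er =
      goodWalk (w ∷ L) (proj₁ (realises-good-walk rz)) (proj₂ (realises-good-walk rz))
        (trans (final-split p (w ∷ L) pre q (r ∷ []) eq) (end-at-leaf er (final-of-path P)))

  module _ {j g d x y : Fin n} (B₁ : Branch j g x) (B₂ : Branch j d y) where
    private
      R₁ : List (Fin n)
      R₁ = Branch.route B₁
      R₂ : List (Fin n)
      R₂ = Branch.route B₂

    joined : List (Fin n)
    joined = glue R₁ g j d R₂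

    joined-ends : Σ (List (Fin n)) λ K → joined ≡ x ∷ K × final x K ≡ y
    joined-ends with glue-ends R₁ g j d R₂
    ... | K , eq , fin = K , subst (λ z → joined ≡ z ∷ K) (Branch.ends B₁) eq ,
                         trans (subst (λ z → final z K ≡ final d R₂) (Branch.ends B₁) fin) (Branch.ends B₂)

    joined-walk : g ≢ d → Walk joined
    joined-walk = walk-glue R₁ g j d R₂ (Branch.walk B₁) (Branch.walk B₂)

    joined-good : Turn g j d → Good joined
    joined-good = good-glue R₁ g j d R₂ (Branch.good B₁) (Branch.good B₂)

    joined-turn : Good joined → Turn g j d
    joined-turn G = proj₁ (Chain₃-suffix (reverse R₁) (g ∷ j ∷ d ∷ R₂) G)

    joined-turn-elsewhere : ∀ {a b c} → Infix₃ a b c joined → b ≢ j → Turn a b c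
    joined-turn-elsewhere {a} {b} {c} i b≢j
      with Infix₃-split (reverse R₁ ++ g ∷ []) j (d ∷ R₂)
             (subst (Infix₃ a b c) (sym (++-assoc (reverse R₁) (g ∷ []) (j ∷ d ∷ R₂))) i) b≢j
    ... | inj₁ left = turn-sym (Chain₃-infix (j ∷ g ∷ R₁) (Branch.good B₁)
            (subst (Infix₃ c b a) (reverse-involutive (j ∷ g ∷ R₁)) (Infix₃-reverse _ left')))
      where
      left' : Infix₃ a b c (reverse (j ∷ g ∷ R₁))
      left' = subst (Infix₃ a b c) (trans (++-assoc (reverse R₁) (g ∷ []) (j ∷ [])) (sym (reverse-∷∷ j g R₁))) left
    ... | inj₂ right = Chain₃-infix (j ∷ d ∷ R₂) (Branch.good B₂) right

    joined-distinct : g ≢ d → x ≢ y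
    joined-distinct g≢d x≡y with reverse-final g R₁
    ... | K' , e = nonEmpty K' (Unique-last-head (final g R₁) (K' ++ j ∷ d ∷ R₂) u
                                  (trans (last-final (final g R₁) (K' ++ j ∷ d ∷ R₂))
                                         (cong just (trans (final-++ (final g R₁) K' j (d ∷ R₂))
                                                           (trans (Branch.ends B₂) (sym (trans (Branch.ends B₁) x≡y)))))))
      where
      u : Unique (final g R₁ ∷ K' ++ j ∷ d ∷ R₂)
      u = subst Unique (trans (sym (++-assoc (reverse R₁) (g ∷ []) (j ∷ d ∷ R₂))) (cong (_++ j ∷ d ∷ R₂) e))
            (walk⇒Unique _ (joined-walk g≢d))
      nonEmpty : ∀ K' → K' ++ j ∷ d ∷ R₂ ≢ []
      nonEmpty [] ()
      nonEmpty (_ ∷ _) ()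

    -- since walks are determined by their ends, every walk from x to y is the joined one
    joined-unique : g ≢ d → ∀ K → Walk (x ∷ K) → final x K ≡ y → x ∷ K ≡ joined
    joined-unique g≢d K W fin with joined-ends
    ... | K₀ , eq , fin₀ =
      trans (cong (x ∷_) (walk-determined x K K₀ W (subst Walk eq (joined-walk g≢d))
        (trans (last-final x K) (trans (cong just (trans fin (sym fin₀))) (sym (last-final x K₀))))))
        (sym eq)

    branches-join : g ≢ d → Turn g j d → GoodWalk x y
    branches-join g≢d t with joined-ends
    ... | K , eq , fin = goodWalk K (subst Walk eq (joined-walk g≢d)) (subst Good eq (joined-good t)) fin

    branches-turn : g ≢ d → GoodWalk x y → Turn g j d
    branches-turn g≢d (goodWalk K W G fin) = joined-turn (subst Good (joined-unique g≢d K W fin) G)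

  no-turn : ∀ {x y z} → lab y x z ≡ false → ¬ Turn x y z
  no-turn f t with trans (sym t) f
  ... | ()

  branches-adjacent : ∀ {j g d x y} (B₁ : Branch j g x) (B₂ : Branch j d y) → g ≢ d → Turn g j d →
                      AltPath (lf x) (lf y)
  branches-adjacent B₁ B₂ g≢d t =
    good-walk⇒leaf-path (branches-join B₁ B₂ g≢d t) (Branch.leaf B₁) (Branch.leaf B₂) (joined-distinct B₁ B₂ g≢d)

  branches-nonadjacent : ∀ {j g d x y} (B₁ : Branch j g x) (B₂ : Branch j d y) → g ≢ d → lab j g d ≡ false →
                         ¬ AltPath (lf x) (lf y)
  branches-nonadjacent B₁ B₂ g≢d f P =
    no-turn f (branches-turn B₁ B₂ g≢d (leaf-path⇒good-walk P (joined-distinct B₁ B₂ g≢d)))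

  record EdgeWalk (u c a v : Fin n) : Set where
    field
      route : List (Fin n)
      pre   : List (Fin n)
      walk  : Walk (u ∷ c ∷ route)
      good  : Good (u ∷ c ∷ route)
      shape : u ∷ c ∷ route ≡ pre ++ a ∷ v ∷ []

  Avoids : Fin n → Fin n → AuxV × AuxV → Set
  Avoids u v st = ¬ InteriorAt u st × ¬ InteriorAt v st

  avoiding-first-step : ∀ {u c v} ws → All (Avoids u v) (steps (mk u c ∷ ws)) → FirstStepTree (mk u c) ws
  avoiding-first-step [] _ = tt
  avoiding-first-step {u} {c} (y ∷ ws) (av ∷ _) v' ia =
    proj₁ av (subst (λ z → InteriorAt z (mk u c , y)) (sym (interior-source ia)) ia)

  end-at-marker : ∀ {r q y v a} → End r q y → y ≡ mk v a → r ≡ v × q ≡ a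
  end-at-marker (markEnd _) refl = refl , refl

  -- a clique-center path is realised by a good walk; it starts with a tree
  -- edge out of u and ends with a tree edge into v since it avoids G_u and G_v
  clique-center-walk : ∀ u c v a → u ≢ v → (P : AltPath (mk u c) (mk v a)) →
                       All (Avoids u v) (steps (mk u c ∷ AltPath.ws P)) → EdgeWalk u c a v
  clique-center-walk u c v a u≢v P av
    with alt-path⇒realises P (u≢v ∘ mk-injectiveˡ) (avoiding-first-step (AltPath.ws P) av)
           (last-step-tree (mk u c ∷ AltPath.ws P) (AltPath.ends P) av
              (λ s v' ia av' → proj₂ av' (subst (λ z → InteriorAt z (s , mk v a)) (sym (interior-target ia)) ia)))
  ... | p , w , L , markEnd _ , rz = walk-of rz
    where
    walk-of : Realises (mk u c ∷ AltPath.ws P) (u ∷ c ∷ L) → EdgeWalk u c a v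
    walk-of rz with EndsAt-last _ _ (realises-EndsAt rz)
    ... | pre , q , r , eq , er with end-at-marker er (final-of-path P)
    ... | r≡v , q≡a = record
      { route = L ; pre = pre ; walk = proj₁ (realises-good-walk rz) ; good = proj₂ (realises-good-walk rz)
      ; shape = trans eq (cong₂ (λ q' r' → pre ++ q' ∷ r' ∷ []) q≡a r≡v) }

  prolong : ∀ {u c a v e x} → EdgeWalk u c a v → Branch u e x → e ≢ c → Turn c u e → Branch v a x
  prolong {u} {c} {a} {v} {e} M (branch Lⱼ W G fin leaf) e≢c turn =
    branch (reverse pre ++ e ∷ Lⱼ)
      (subst Walk reshape (walk-glue route c u e Lⱼ walk W (e≢c ∘ sym)))
      (subst Good reshape (good-glue route c u e Lⱼ good G turn))
      (trans (final-++ a (reverse pre) e Lⱼ) fin) leaf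
    where
    open EdgeWalk M
    reshape : glue route c u e Lⱼ ≡ v ∷ a ∷ reverse pre ++ e ∷ Lⱼ
    reshape = begin
      reverse route ++ c ∷ u ∷ e ∷ Lⱼ           ≡⟨ sym (++-assoc (reverse route) (c ∷ u ∷ []) (e ∷ Lⱼ)) ⟩
      (reverse route ++ c ∷ u ∷ []) ++ e ∷ Lⱼ   ≡⟨ cong (_++ e ∷ Lⱼ) (sym (reverse-∷∷ u c route)) ⟩
      reverse (u ∷ c ∷ route) ++ e ∷ Lⱼ         ≡⟨ cong (λ z → reverse z ++ e ∷ Lⱼ) shape ⟩
      reverse (pre ++ a ∷ v ∷ []) ++ e ∷ Lⱼ     ≡⟨ cong (_++ e ∷ Lⱼ) (reverse-++ pre (a ∷ v ∷ [])) ⟩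
      v ∷ a ∷ reverse pre ++ e ∷ Lⱼ             ∎
      where open ≡-Reasoning

  -- a star node is not a clique node: its two extremities are not adjacent
  star-not-clique : ∀ {u c} → IsCenter u c → CliqueNode u → ⊥
  star-not-clique {u} {c} (iu , _ , _ , extremities) (_ , clique) =
    no-turn (extremities e₁ e₂ adj₁ adj₂ e₁≢c e₂≢c) (clique e₁ e₂ adj₁ adj₂ e₁≢e₂)
    where open OtherPair (other-pair u c iu)

  -- (⇒) two extremities e₁, e₂ of the star u and two markers b₁, b₂ ≠ a of
  -- the clique v lead to leaves x₁, x₂, y₁, y₂; all pairs are joined through
  -- v (and the path from v to u) except x₁, x₂, which meet at u through e₁, e₂
  clique-center-path⇒diamond-leaves : HasCliqueCenterPath → DiamondLeaves T
  clique-center-path⇒diamond-leaves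
    (u , c , v , a , center@(iu , _ , center-turn , extremities) , clique@(iv , clique-turn) , va , P , avoids) =
    diamondLeaves y₁ y₂ x₁ x₂ (Branch.leaf Y₁) (Branch.leaf Y₂) (Branch.leaf X₁) (Branch.leaf X₂)
      (joined-distinct Y₁ Y₂ V.e₁≢e₂) (joined-distinct Y₁ Z₁ V.e₁≢c) (joined-distinct Y₁ Z₂ V.e₁≢c)
      (joined-distinct Y₂ Z₁ V.e₂≢c) (joined-distinct Y₂ Z₂ V.e₂≢c) (joined-distinct X₁ X₂ U.e₁≢e₂)
      (branches-adjacent Y₁ Y₂ V.e₁≢e₂ (clique-turn V.e₁ V.e₂ V.adj₁ V.adj₂ V.e₁≢e₂))
      (branches-adjacent Y₁ Z₁ V.e₁≢c (clique-turn V.e₁ a V.adj₁ va V.e₁≢c))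
      (branches-adjacent Y₁ Z₂ V.e₁≢c (clique-turn V.e₁ a V.adj₁ va V.e₁≢c))
      (branches-adjacent Y₂ Z₁ V.e₂≢c (clique-turn V.e₂ a V.adj₂ va V.e₂≢c))
      (branches-adjacent Y₂ Z₂ V.e₂≢c (clique-turn V.e₂ a V.adj₂ va V.e₂≢c))
      (branches-nonadjacent X₁ X₂ U.e₁≢e₂ (extremities U.e₁ U.e₂ U.adj₁ U.adj₂ U.e₁≢c U.e₂≢c))
    where
    u≢v : u ≢ v
    u≢v refl = star-not-clique center clique
    M : EdgeWalk u c a v
    M = clique-center-walk u c v a u≢v P (All-from-indices _ avoids)
    module U = OtherPair (other-pair u c iu)
    module V = OtherPair (other-pair v a iv)
    x₁ x₂ y₁ y₂ : Fin n
    x₁ = proj₁ (to-leaf u U.e₁ U.adj₁)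
    x₂ = proj₁ (to-leaf u U.e₂ U.adj₂)
    y₁ = proj₁ (to-leaf v V.e₁ V.adj₁)
    y₂ = proj₁ (to-leaf v V.e₂ V.adj₂)
    X₁ : Branch u U.e₁ x₁
    X₁ = proj₂ (to-leaf u U.e₁ U.adj₁)
    X₂ : Branch u U.e₂ x₂
    X₂ = proj₂ (to-leaf u U.e₂ U.adj₂)
    Y₁ : Branch v V.e₁ y₁
    Y₁ = proj₂ (to-leaf v V.e₁ V.adj₁)
    Y₂ : Branch v V.e₂ y₂
    Y₂ = proj₂ (to-leaf v V.e₂ V.adj₂)
    -- the branches X₁, X₂ seen from v
    Z₁ : Branch v a x₁
    Z₁ = prolong M X₁ U.e₁≢c (center-turn U.e₁ U.adj₁ U.e₁≢c)
    Z₂ : Branch v a x₂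
    Z₂ = prolong M X₂ U.e₂≢c (center-turn U.e₂ U.adj₂ U.e₂≢c)

  record Fork (p x ℓ₁ ℓ₂ : Fin n) : Set where
    constructor fork
    field
      q s σ₁ σ₂  : Fin n
      stem pre   : List (Fin n)
      stem-walk  : Walk (p ∷ x ∷ stem)
      stem-good  : Good (p ∷ x ∷ stem)
      stem-shape : p ∷ x ∷ stem ≡ pre ++ q ∷ s ∷ []
      adj-q      : Adj s q
      branch₁    : Branch s σ₁ ℓ₁
      branch₂    : Branch s σ₂ ℓ₂
      σ₁≢σ₂      : σ₁ ≢ σ₂
      q≢σ₁       : q ≢ σ₁
      q≢σ₂       : q ≢ σ₂
      turn₁      : Turn q s σ₁
      turn₂      : Turn q s σ₂

  leaf-not-inner : ∀ {p x w R} → Walk (p ∷ x ∷ w ∷ R) → ¬ Leaf x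
  leaf-not-inner ((apx , axw , _) , (p≢w , _)) l = leaf-not-internal l (two-neighbours⇒internal (adj-sym apx) axw p≢w)

  -- forks are found by following both routes while they agree
  fork-routes : ∀ {p x ℓ₁ ℓ₂} U W → Walk (p ∷ x ∷ U) → Good (p ∷ x ∷ U) → final x U ≡ ℓ₁ → Leaf ℓ₁ →
                Walk (p ∷ x ∷ W) → Good (p ∷ x ∷ W) → final x W ≡ ℓ₂ → Leaf ℓ₂ → ℓ₁ ≢ ℓ₂ → Fork p x ℓ₁ ℓ₂
  fork-routes [] [] _ _ e₁ _ _ _ e₂ _ ℓ₁≢ℓ₂ = ⊥-elim (ℓ₁≢ℓ₂ (trans (sym e₁) e₂))
  fork-routes [] (w ∷ W) _ _ refl l₁ W₂ _ _ _ _ = ⊥-elim (leaf-not-inner W₂ l₁)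
  fork-routes (u ∷ U) [] W₁ _ _ _ _ _ refl l₂ _ = ⊥-elim (leaf-not-inner W₁ l₂)
  fork-routes {p} {x} (u ∷ U) (w ∷ W) W₁ G₁ e₁ l₁ W₂ G₂ e₂ l₂ ℓ₁≢ℓ₂ with u ≟F w
  ... | no u≢w = fork p x u w [] [] ((proj₁ (proj₁ W₁) , tt) , tt) tt refl (adj-sym (proj₁ (proj₁ W₁)))
                  (branch U (walk-tail p _ W₁) (Chain₃-tail p _ G₁) e₁ l₁)
                  (branch W (walk-tail p _ W₂) (Chain₃-tail p _ G₂) e₂ l₂)
                  u≢w (proj₁ (proj₂ W₁)) (proj₁ (proj₂ W₂)) (proj₁ G₁) (proj₁ G₂)
  ... | yes refl with fork-routes U W (walk-tail p _ W₁) (Chain₃-tail p _ G₁) e₁ l₁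
                                      (walk-tail p _ W₂) (Chain₃-tail p _ G₂) e₂ l₂ ℓ₁≢ℓ₂
  ... | fork q s σ₁ σ₂ stem pre (lk , nb) good shape adj-q b₁ b₂ σ₁≢σ₂ q≢σ₁ q≢σ₂ t₁ t₂ =
    fork q s σ₁ σ₂ (u ∷ stem) (p ∷ pre) ((proj₁ (proj₁ W₁) , lk) , (proj₁ (proj₂ W₁) , nb)) (proj₁ G₁ , good)
         (cong (p ∷_) shape) adj-q b₁ b₂ σ₁≢σ₂ q≢σ₁ q≢σ₂ t₁ t₂

  forking : ∀ {p x ℓ₁ ℓ₂} → Branch p x ℓ₁ → Branch p x ℓ₂ → ℓ₁ ≢ ℓ₂ → Fork p x ℓ₁ ℓ₂
  forking (branch U W₁ G₁ e₁ l₁) (branch W W₂ G₂ e₂ l₂) = fork-routes U W W₁ G₁ e₁ l₁ W₂ G₂ e₂ l₂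

  stem-back : ∀ {A x ℓ₁ ℓ₂} (F : Fork A x ℓ₁ ℓ₂) → Leaf A → Branch (Fork.s F) (Fork.q F) A
  stem-back {A} {x} (fork q s _ _ stem pre W G shape _ _ _ _ _ _ _ _) lA =
    branch (reverse pre) (subst Walk reshape (walk-reverse _ W)) (subst Good reshape (good-reverse _ G))
      (final-reverse-prefix A (x ∷ stem) pre q (s ∷ []) shape) lA
    where
    reshape : reverse (A ∷ x ∷ stem) ≡ s ∷ q ∷ reverse pre
    reshape = trans (cong reverse shape) (reverse-++ pre (q ∷ s ∷ []))

  star-center : ∀ t α g d → Internal t → Adj t α → Adj t g → Adj t d → α ≢ g → g ≢ d →
                Turn α t g → Turn α t d → lab t g d ≡ false → IsCenter t α
  star-center t α g d it aα ag ad α≢g g≢d tg td nt with clique-or-star t it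
  ... | inj₁ (_ , clique) = ⊥-elim (no-turn nt (clique g d ag ad g≢d))
  ... | inj₂ (κ , isc@(_ , _ , κ-turn , κ-extremities)) with α ≟F κ | g ≟F κ
  ... | yes refl | _ = isc
  ... | no α≢κ | yes refl = ⊥-elim (no-turn nt (κ-turn d ad (g≢d ∘ sym)))
  ... | no α≢κ | no g≢κ = ⊥-elim (no-turn (κ-extremities α g aα ag α≢κ g≢κ) tg)

  three-clique : ∀ s x y z → Internal s → Adj s x → Adj s y → Adj s z → x ≢ y → x ≢ z → y ≢ z →
                 Turn x s y → Turn x s z → Turn y s z → CliqueNode s
  three-clique s x y z is ax ay az x≢y x≢z y≢z txy txz tyz with clique-or-star s is
  ... | inj₁ clique = clique
  ... | inj₂ (κ , (_ , _ , _ , κ-extremities)) with x ≟F κ | y ≟F κ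
  ... | yes refl | _ = ⊥-elim (no-turn (κ-extremities y z ay az (x≢y ∘ sym) (x≢z ∘ sym)) tyz)
  ... | no x≢κ | yes refl = ⊥-elim (no-turn (κ-extremities x z ax az x≢κ (y≢z ∘ sym)) txz)
  ... | no x≢κ | no y≢κ = ⊥-elim (no-turn (κ-extremities x y ax ay x≢κ y≢κ) txy)

  center-unique : ∀ t α α' g d → IsCenter t α → IsCenter t α' → Adj t g → Adj t d → g ≢ α → d ≢ α → g ≢ d → α ≡ α'
  center-unique t α α' g d (_ , aα , α-turn , _) (_ , _ , _ , α'-extremities) ag ad g≢α d≢α g≢d with α ≟F α' | g ≟F α'
  ... | yes α≡α' | _ = α≡α'
  ... | no α≢α' | no g≢α' = ⊥-elim (no-turn (α'-extremities α g aα ag α≢α' g≢α') (α-turn g ag g≢α))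
  ... | no α≢α' | yes refl = ⊥-elim (no-turn (α'-extremities α d aα ad α≢α' (g≢d ∘ sym)) (α-turn d ad d≢α))

  record StarSplit (A C D : Fin n) : Set where
    constructor starSplit
    field
      t α g d : Fin n
      center  : IsCenter t α
      back    : Branch t α A
      toC     : Branch t g C
      toD     : Branch t d D
      g≢d     : g ≢ d
      g≢α     : g ≢ α
      d≢α     : d ≢ α
      no-turn-gd : lab t g d ≡ false

  star-split : ∀ {A C D} → Leaf A → Leaf C → Leaf D → A ≢ C → A ≢ D → C ≢ D →
               GoodWalk A C → GoodWalk A D → ¬ GoodWalk C D → StarSplit A C D
  star-split lA lC lD A≢C A≢D C≢D (goodWalk [] _ _ e) _ _ = ⊥-elim (A≢C e)
  star-split lA lC lD A≢C A≢D C≢D (goodWalk (u ∷ U) _ _ _) (goodWalk [] _ _ e) _ = ⊥-elim (A≢D e)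
  star-split {A} lA lC lD A≢C A≢D C≢D (goodWalk (u ∷ U) W₁ G₁ e₁) (goodWalk (w ∷ W) W₂ G₂ e₂) ¬CD
    with leaf-unique-neighbour lA (proj₁ (proj₁ W₁)) (proj₁ (proj₁ W₂))
  ... | refl with forking (branch U W₁ G₁ e₁ lC) (branch W W₂ G₂ e₂ lD) C≢D
  ... | F@(fork q s σ₁ σ₂ _ _ _ _ _ adj-q b₁ b₂ σ₁≢σ₂ q≢σ₁ q≢σ₂ t₁ t₂) with lab s σ₁ σ₂ in σ-turn
  ... | true = ⊥-elim (¬CD (branches-join b₁ b₂ σ₁≢σ₂ σ-turn))
  ... | false = starSplit s q σ₁ σ₂ center (stem-back F lA) b₁ b₂ σ₁≢σ₂ (q≢σ₁ ∘ sym) (q≢σ₂ ∘ sym) σ-turn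
    where
    center : IsCenter s q
    center = star-center s q σ₁ σ₂ (two-neighbours⇒internal adj-q a₁ q≢σ₁) adj-q a₁ (proj₁ (proj₁ (Branch.walk b₂)))
               q≢σ₁ σ₁≢σ₂ t₁ t₂ σ-turn
      where a₁ = proj₁ (proj₁ (Branch.walk b₁))

  -- the star node of the split is the same seen from any of the leaves A, B:
  -- the good walks from C to D through the two splits coincide, and away from
  -- its star node each turns
  same-star : ∀ {A B C D} (S₁ : StarSplit A C D) (S₂ : StarSplit B C D) → StarSplit.t S₂ ≡ StarSplit.t S₁
  same-star (starSplit t α g d _ _ toC toD g≢d _ _ _) (starSplit t' α' g' d' _ _ toC' toD' g'≢d' _ _ nt') with t' ≟F t
  ... | yes t'≡t = t'≡t
  ... | no t'≢t = ⊥-elim (no-turn nt' (joined-turn-elsewhere toC toD (subst (Infix₃ g' t' d') same infix') t'≢t))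
    where
    infix' : Infix₃ g' t' d' (joined toC' toD')
    infix' = reverse (Branch.route toC') , Branch.route toD' , refl
    same : joined toC' toD' ≡ joined toC toD
    same with joined-ends toC' toD'
    ... | K , eq , fin = trans eq (joined-unique toC toD g≢d K (subst Walk eq (joined-walk toC' toD' g'≢d')) fin)

  -- seen from B, the split of C and D is at the same star with the same
  -- center, so it provides a branch from there to B
  realign : ∀ {A B C D} (S₁ : StarSplit A C D) → StarSplit B C D → Branch (StarSplit.t S₁) (StarSplit.α S₁) B
  realign S₁@(starSplit t α g d center _ toC toD g≢d g≢α d≢α _) S₂@(starSplit t' α' _ _ center' back' _ _ _ _ _ _)
    with same-star S₁ S₂
  ... | refl with center-unique t α α' g d center center' (proj₁ (proj₁ (Branch.walk toC))) (proj₁ (proj₁ (Branch.walk toD)))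
                    g≢α d≢α g≢d
  ... | refl = back'

  -- the branches from the star t through its center α towards the adjacent
  -- leaves A and B fork at a node s with three pairwise adjacent markers; so
  -- s is a clique node and the stem from α to s is a clique-center path
  fork⇒clique-center-path : ∀ {t α A B} → IsCenter t α → Branch t α A → Branch t α B → A ≢ B → GoodWalk A B →
                            HasCliqueCenterPath
  fork⇒clique-center-path {t} {α} center bA bB A≢B AB with forking bA bB A≢B
  ... | fork q s σ₁ σ₂ stem pre W G shape adj-q b₁ b₂ σ₁≢σ₂ q≢σ₁ q≢σ₂ t₁ t₂ =
    t , α , s , q , center , clique , adj-q , proj₁ path ,
    λ k → All-at (realises-avoids-first (proj₂ path) u) k ,
          subst (λ z → ¬ InteriorAt z (lookup (steps (mk t α ∷ AltPath.ws (proj₁ path))) k)) final-is-s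
            (All-at (realises-avoids-final (proj₂ path) u) k)
    where
    is : Internal s
    is = two-neighbours⇒internal adj-q (proj₁ (proj₁ (Branch.walk b₁))) q≢σ₁
    clique : CliqueNode s
    clique = three-clique s q σ₁ σ₂ is adj-q (proj₁ (proj₁ (Branch.walk b₁))) (proj₁ (proj₁ (Branch.walk b₂)))
               q≢σ₁ q≢σ₂ σ₁≢σ₂ t₁ t₂ (branches-turn b₁ b₂ σ₁≢σ₂ AB)
    path : Σ (AltPath (mk t α) (mk s q)) λ P → Realises (mk t α ∷ AltPath.ws P) (t ∷ α ∷ stem)
    path = realise-good-walk t α stem (mk t α) (mk s q) (markEnd (proj₁ center)) W G
             (subst (EndsAt (mk s q)) (sym shape) (EndsAt-++ (mk s q) pre q s [] (markEnd is)))
    u : Unique (t ∷ α ∷ stem)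
    u = walk⇒Unique _ W
    final-is-s : final t (α ∷ stem) ≡ s
    final-is-s = final-split t (α ∷ stem) pre q (s ∷ []) shape

  -- (⇐) the split of C, D seen from A and from B is at the same star t with
  -- the same center α, and the branches back to A and B fork at a clique
  diamond-leaves⇒clique-center-path : DiamondLeaves T → HasCliqueCenterPath
  diamond-leaves⇒clique-center-path (diamondLeaves A B C D lA lB lC lD A≢B A≢C A≢D B≢C B≢D C≢D ab ac ad bc bd ¬cd) =
    fork⇒clique-center-path (StarSplit.center S₁) (StarSplit.back S₁) (realign S₁ S₂) A≢B (leaf-path⇒good-walk ab A≢B)
    where
    ¬CD : ¬ GoodWalk C D
    ¬CD CD = ¬cd (good-walk⇒leaf-path CD lC lD C≢D)
    S₁ : StarSplit A C D
    S₁ = star-split lA lC lD A≢C A≢D C≢D (leaf-path⇒good-walk ac A≢C) (leaf-path⇒good-walk ad A≢D) ¬CD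
    S₂ : StarSplit B C D
    S₂ = star-split lB lC lD B≢C B≢D C≢D (leaf-path⇒good-walk bc B≢C) (leaf-path⇒good-walk bd B≢D) ¬CD

  clique-center-path⇔diamond-leaves : HasCliqueCenterPath ⇔ DiamondLeaves T
  clique-center-path⇔diamond-leaves = mk⇔ clique-center-path⇒diamond-leaves diamond-leaves⇒clique-center-path

module Accessibility {m n : ℕ} (G : SimpleGraph m) (T : LabeledTree n) (acc : IsAccessibilityGraph G T) where

  open LabeledTree T
  open SimpleGraph G using (adj)

  φ : Fin m → Fin n
  φ = proj₁ acc

  φ-injective : ∀ x y → φ x ≡ φ y → x ≡ y
  φ-injective = proj₁ (proj₂ acc)

  φ-leaf : ∀ x → Leaf (φ x)
  φ-leaf = proj₁ (proj₂ (proj₂ acc))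

  φ-onto : ∀ ℓ → Leaf ℓ → Σ (Fin m) λ x → φ x ≡ ℓ
  φ-onto = proj₁ (proj₂ (proj₂ (proj₂ acc)))

  adjacent⇒path : ∀ x y → x ≢ y → adj x y ≡ true → AltPath (lf (φ x)) (lf (φ y))
  adjacent⇒path x y x≢y = proj₁ (proj₂ (proj₂ (proj₂ (proj₂ acc))) x y x≢y)

  path⇒adjacent : ∀ x y → x ≢ y → AltPath (lf (φ x)) (lf (φ y)) → adj x y ≡ true
  path⇒adjacent x y x≢y = proj₂ (proj₂ (proj₂ (proj₂ (proj₂ acc))) x y x≢y)

  φ-distinct : ∀ {x y} → x ≢ y → φ x ≢ φ y
  φ-distinct x≢y e = x≢y (φ-injective _ _ e)

  diamond⇒diamond-leaves : HasInducedDiamond G → DiamondLeaves T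
  diamond⇒diamond-leaves (a , b , c , d , (a≢b , a≢c , a≢d , b≢c , b≢d , c≢d) , (ab , ac , ad , bc , bd , ¬cd)) =
    diamondLeaves (φ a) (φ b) (φ c) (φ d) (φ-leaf a) (φ-leaf b) (φ-leaf c) (φ-leaf d)
      (φ-distinct a≢b) (φ-distinct a≢c) (φ-distinct a≢d) (φ-distinct b≢c) (φ-distinct b≢d) (φ-distinct c≢d)
      (adjacent⇒path a b a≢b ab) (adjacent⇒path a c a≢c ac) (adjacent⇒path a d a≢d ad)
      (adjacent⇒path b c b≢c bc) (adjacent⇒path b d b≢d bd) non-adjacent
    where
    non-adjacent : ¬ AltPath (lf (φ c)) (lf (φ d))
    non-adjacent P with trans (sym (path⇒adjacent c d c≢d P)) ¬cd
    ... | ()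

  diamond-leaves⇒diamond : DiamondLeaves T → HasInducedDiamond G
  diamond-leaves⇒diamond (diamondLeaves A B C D lA lB lC lD A≢B A≢C A≢D B≢C B≢D C≢D ab ac ad bc bd ¬cd)
    with φ-onto A lA | φ-onto B lB | φ-onto C lC | φ-onto D lD
  ... | a , refl | b , refl | c , refl | d , refl =
    a , b , c , d , (a≢b , a≢c , a≢d , b≢c , b≢d , c≢d) ,
    (path⇒adjacent a b a≢b ab , path⇒adjacent a c a≢c ac , path⇒adjacent a d a≢d ad ,
     path⇒adjacent b c b≢c bc , path⇒adjacent b d b≢d bd , non-adjacent (adj c d) refl)
    where
    preimages-distinct : ∀ {x y} → φ x ≢ φ y → x ≢ y
    preimages-distinct ne refl = ne refl
    a≢b = preimages-distinct A≢B
    a≢c = preimages-distinct A≢C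
    a≢d = preimages-distinct A≢D
    b≢c = preimages-distinct B≢C
    b≢d = preimages-distinct B≢D
    c≢d = preimages-distinct C≢D
    non-adjacent : ∀ e → adj c d ≡ e → adj c d ≡ false
    non-adjacent false cd = cd
    non-adjacent true cd = ⊥-elim (¬cd (adjacent⇒path c d c≢d cd))

  diamond⇔diamond-leaves : HasInducedDiamond G ⇔ DiamondLeaves T
  diamond⇔diamond-leaves = mk⇔ diamond⇒diamond-leaves diamond-leaves⇒diamond

-- Both conditions say that T has no diamond leaves.
lemma8 : ∀ {m n} (G : SimpleGraph m) (T : LabeledTree n) →
    Connected G → IsReducedCliqueStarTreeOf G T →
    (¬ HasInducedDiamond G) ⇔ (¬ LabeledTree.HasCliqueCenterPath T)
lemma8 G T _ (RT , acc) =
  ¬-cong-⇔ (⇔-trans (Accessibility.diamond⇔diamond-leaves G T acc)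
                     (⇔-sym (SplitTree.clique-center-path⇔diamond-leaves T RT)))
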